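{- Let $\Gamma$ be a base graph on $n$ vertices, labeled $1,\dots,n$, and let $G$ be a $\Gamma$-reseminant graph. For $i\in\{1,\dots,n\}$ let $V_i\subseteq V(G)$ be the set of true twins of the vertex $i$ in $G$ (including $i$), let $h_i=|V_i|$, and let $H=\{\varphi\in\mathrm{Aut}(G) : \varphi(V_i)=V_i \text{ for all } i\}$, which is a normal subgroup of $\mathrm{Aut}(G)$ isomorphic to $S_{h_1}\times\cdots\times S_{h_n}$. Then $\mathrm{Aut}(G)/H$ is isomorphic to a subgroup $K$ of $\mathrm{Aut}(\Gamma)$.
   Context: All graphs are finite, simple and undirected. $N_1[v]$ denotes the closed neighborhood of $v$. Two vertices $u,v$ are true twins if $N_1[u]=N_1[v]$. A base graph is a graph in which no two distinct vertices are true twins. Vertex duplication of a vertex $w$ adds a new vertex $w'$ adjacent exactly to the vertices of $N_1[w]$. A $\Gamma$-reseminant graph is a graph obtained from $\Gamma$ by a finite number (possibly zero) of vertex duplications; it contains $\Gamma$ as the induced subgraph on the original vertices $1,\dots,n$. The sets $V_1,\dots,V_n$ partition $V(G)$, and every automorphism of $G$ permutes them. -}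

module Defs where

open import Data.Nat using (ℕ; zero; suc)
open import Data.Fin using (Fin; zero; suc; _≟_)
open import Data.Bool using (Bool; true; false; _∨_)
open import Data.Product using (Σ; _×_; _,_; ∃)
open import Relation.Nullary using (¬_)
open import Relation.Nullary.Decidable using (⌊_⌋)
open import Relation.Binary.PropositionalEquality using (_≡_; refl; trans; cong₂)
open import Function.Bundles using (_⇔_)
open import Data.Fin.Permutation using (Permutation′; _⟨$⟩ʳ_; _⟨$⟩ˡ_; _∘ₚ_; flip; inverseʳ)
import Data.Fin.Permutation as P

record Graph (m : ℕ) : Set where
  field
    adj    : Fin m → Fin m → Bool
    sym    : ∀ x y → adj x y ≡ adj y x
    irrefl : ∀ x → adj x x ≡ false
open Graph public

_==_ : ∀ {m} → Fin m → Fin m → Bool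
x == y = ⌊ x ≟ y ⌋

closedAdj : ∀ {m} → Graph m → Fin m → Fin m → Bool
closedAdj G u x = (u == x) ∨ adj G u x

TrueTwins : ∀ {m} → Graph m → Fin m → Fin m → Set
TrueTwins G u v = ∀ x → closedAdj G u x ≡ closedAdj G v x

IsBase : ∀ {n} → Graph n → Set
IsBase Γ = ∀ u v → TrueTwins Γ u v → u ≡ v

-- Vertex duplication of w: the new vertex is `zero`, old vertex x becomes `suc x`.
-- The new vertex is adjacent exactly to the (images of the) vertices of N₁[w].
dupAdj : ∀ {m} → Graph m → Fin m → Fin (suc m) → Fin (suc m) → Bool
dupAdj G w zero    zero    = false
dupAdj G w zero    (suc y) = closedAdj G w y
dupAdj G w (suc x) zero    = closedAdj G w x
dupAdj G w (suc x) (suc y) = adj G x y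

dupSym : ∀ {m} (G : Graph m) (w : Fin m) x y → dupAdj G w x y ≡ dupAdj G w y x
dupSym G w zero    zero    = refl
dupSym G w zero    (suc y) = refl
dupSym G w (suc x) zero    = refl
dupSym G w (suc x) (suc y) = sym G x y

dupIrrefl : ∀ {m} (G : Graph m) (w : Fin m) x → dupAdj G w x x ≡ false
dupIrrefl G w zero    = refl
dupIrrefl G w (suc x) = irrefl G x

duplicate : ∀ {m} → Graph m → Fin m → Graph (suc m)
duplicate G w = record { adj = dupAdj G w ; sym = dupSym G w ; irrefl = dupIrrefl G w }

data Dups (n : ℕ) : ℕ → Set where
  done : Dups n n
  dup  : ∀ {m} → Dups n m → Fin m → Dups n (suc m)

build : ∀ {n m} → Graph n → Dups n m → Graph m
build Γ done      = Γ
build Γ (dup d w) = duplicate (build Γ d) w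

orig : ∀ {n m} → Dups n m → Fin n → Fin m
orig done      i = i
orig (dup d w) i = suc (orig d i)

record Aut {m : ℕ} (G : Graph m) : Set where
  field
    perm     : Permutation′ m
    preserve : ∀ x y → adj G (perm ⟨$⟩ʳ x) (perm ⟨$⟩ʳ y) ≡ adj G x y
open Aut public

_$ₐ_ : ∀ {m} {G : Graph m} → Aut G → Fin m → Fin m
σ $ₐ x = perm σ ⟨$⟩ʳ x

_≈ₐ_ : ∀ {m} {G : Graph m} → Aut G → Aut G → Set
σ ≈ₐ τ = ∀ x → σ $ₐ x ≡ τ $ₐ x

idAut : ∀ {m} {G : Graph m} → Aut G
idAut = record { perm = P.id ; preserve = λ x y → refl }

-- composition: (σ ∘ₐ τ) x = σ (τ x)
_∘ₐ_ : ∀ {m} {G : Graph m} → Aut G → Aut G → Aut G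
_∘ₐ_ {G = G} σ τ = record
  { perm = perm τ ∘ₚ perm σ
  ; preserve = λ x y → trans (preserve σ (τ $ₐ x) (τ $ₐ y)) (preserve τ x y) }

invAut : ∀ {m} {G : Graph m} → Aut G → Aut G
invAut {G = G} σ = record
  { perm = flip (perm σ)
  ; preserve = λ x y → trans
      (sym' (preserve σ (perm σ ⟨$⟩ˡ x) (perm σ ⟨$⟩ˡ y)))
      (cong₂ (adj G) (inverseʳ (perm σ) {x}) (inverseʳ (perm σ) {y})) }
  where
  sym' : ∀ {A : Set} {a b : A} → a ≡ b → b ≡ a
  sym' refl = refl

InV : ∀ {n m} → Graph n → (d : Dups n m) → Fin n → Fin m → Set
InV Γ d i v = TrueTwins (build Γ d) (orig d i) v

InH : ∀ {n m} (Γ : Graph n) (d : Dups n m) → Aut (build Γ d) → Set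
InH Γ d φ = ∀ i v → InV Γ d i v ⇔ InV Γ d i (φ $ₐ v)

record IsSubgroup {n} (Γ : Graph n) (K : Aut Γ → Set) : Set where
  field
    resp   : ∀ {σ τ} → σ ≈ₐ τ → K σ → K τ
    hasId  : K idAut
    closed : ∀ {σ τ} → K σ → K τ → K (σ ∘ₐ τ)
    hasInv : ∀ {σ} → K σ → K (invAut σ)

-- Aut(G)/H ≅ K: a map f : Aut(G) → Aut(Γ) that is a group homomorphism, lands in K,
-- is onto K, and satisfies f σ = f τ ⇔ σ H = τ H (i.e. σ⁻¹τ ∈ H); thus f induces a
-- well-defined, injective, surjective homomorphism from the coset group Aut(G)/H onto K.
record QuotientIso {n m} (Γ : Graph n) (d : Dups n m) (K : Aut Γ → Set) : Set where
  field
    f        : Aut (build Γ d) → Aut Γ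
    hom      : ∀ σ τ → f (σ ∘ₐ τ) ≈ₐ (f σ ∘ₐ f τ)
    into     : ∀ σ → K (f σ)
    onto     : ∀ κ → K κ → Σ (Aut (build Γ d)) (λ σ → f σ ≈ₐ κ)
    kerIsH   : ∀ σ τ → (f σ ≈ₐ f τ) ⇔ InH Γ d (invAut σ ∘ₐ τ)

{-# OPTIONS --safe #-}
module Submission where

-- Every vertex of a reseminant graph descends from a unique vertex of Γ, and
-- whether two vertices are equal-or-adjacent depends only on their ancestors.  Since
-- Γ is a base graph, the true-twin classes of G are exactly the fibres of the
-- ancestor map, so every automorphism of G permutes the fibres and thereby
-- induces an automorphism of Γ.  This is a homomorphism Aut(G) → Aut(Γ) whose
-- kernel is H; K is its image.

open import Defs hiding (sym)
open import Data.Product using (Σ; _×_; _,_)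
open import Data.Bool using (true; false; _∨_)
open import Data.Fin using (Fin; zero; suc; _≟_)
open import Data.Fin.Permutation
  using (Permutation′; permutation; inverseˡ; inverseʳ)
open import Function.Base using (_∘_)
open import Function.Bundles using (_⇔_; mk⇔; Injection; Equivalence)
open import Function.Construct.Composition using (_⇔-∘_)
open import Function.Definitions using (Injective)
open import Function.Properties.Inverse using (↔⇒↣)
open import Relation.Nullary using (yes; no)
open import Relation.Nullary.Decidable using (isYes≗does; dec-true; dec-false; ⌊⌋-map′)
open import Relation.Binary.PropositionalEquality
  using (_≡_; _≢_; refl; sym; trans; cong; cong₂; module ≡-Reasoning)

open ≡-Reasoning

==-≡ : ∀ {m} {x y : Fin m} → x ≡ y → (x == y) ≡ true
==-≡ {x = x} {y} x≡y = trans (isYes≗does (x ≟ y)) (dec-true (x ≟ y) x≡y)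

==-≢ : ∀ {m} {x y : Fin m} → x ≢ y → (x == y) ≡ false
==-≢ {x = x} {y} x≢y = trans (isYes≗does (x ≟ y)) (dec-false (x ≟ y) x≢y)

==-sym : ∀ {m} (x y : Fin m) → (x == y) ≡ (y == x)
==-sym x y with x ≟ y
... | yes refl = sym (==-≡ refl)
... | no x≢y   = sym (==-≢ (x≢y ∘ sym))

==-suc : ∀ {m} (x y : Fin m) → (Fin.suc x == suc y) ≡ (x == y)
==-suc x y = ⌊⌋-map′ _ _ (x ≟ y)

==-injective : ∀ {m k} (g : Fin m → Fin k) → Injective _≡_ _≡_ g →
               ∀ x y → (g x == g y) ≡ (x == y)
==-injective g g-inj x y with x ≟ y
... | yes refl = ==-≡ refl
... | no x≢y   = ==-≢ (x≢y ∘ g-inj)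

closedAdj-refl : ∀ {m} (G : Graph m) x → closedAdj G x x ≡ true
closedAdj-refl G x = cong (_∨ adj G x x) (==-≡ refl)

closedAdj-sym : ∀ {m} (G : Graph m) x y → closedAdj G x y ≡ closedAdj G y x
closedAdj-sym G x y = cong₂ _∨_ (==-sym x y) (Graph.sym G x y)

closedAdj-≢ : ∀ {m} (G : Graph m) {x y} → x ≢ y → closedAdj G x y ≡ adj G x y
closedAdj-≢ G {x} {y} x≢y = cong (_∨ adj G x y) (==-≢ x≢y)

PreservesClosedAdj : ∀ {m} → Graph m → (Fin m → Fin m) → Set
PreservesClosedAdj G h = ∀ x y → closedAdj G (h x) (h y) ≡ closedAdj G x y

preservesClosedAdj⇒preservesAdj : ∀ {m} (G : Graph m) (h : Fin m → Fin m) →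
  Injective _≡_ _≡_ h → PreservesClosedAdj G h →
  ∀ x y → adj G (h x) (h y) ≡ adj G x y
preservesClosedAdj⇒preservesAdj G h h-inj h-cl x y with x ≟ y
... | yes refl = trans (irrefl G (h x)) (sym (irrefl G x))
... | no x≢y   = begin
  adj G (h x) (h y)        ≡⟨ sym (closedAdj-≢ G (x≢y ∘ h-inj)) ⟩
  closedAdj G (h x) (h y)  ≡⟨ h-cl x y ⟩
  closedAdj G x y          ≡⟨ closedAdj-≢ G x≢y ⟩
  adj G x y                ∎

module _ {m} {G : Graph m} where

  $ₐ-injective : (σ : Aut G) → Injective _≡_ _≡_ (σ $ₐ_)
  $ₐ-injective σ = Injection.injective (↔⇒↣ (perm σ))

  aut-preservesClosedAdj : (σ : Aut G) → PreservesClosedAdj G (σ $ₐ_)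
  aut-preservesClosedAdj σ x y =
    cong₂ _∨_ (==-injective (σ $ₐ_) ($ₐ-injective σ) x y) (preserve σ x y)

  aut-trueTwins : (σ : Aut G) → ∀ {u v} → TrueTwins G u v →
                  TrueTwins G (σ $ₐ u) (σ $ₐ v)
  aut-trueTwins σ {u} {v} uv x = begin
    closedAdj G (σ $ₐ u) x          ≡⟨ cong (closedAdj G (σ $ₐ u)) (sym (inverseʳ (perm σ))) ⟩
    closedAdj G (σ $ₐ u) (σ $ₐ x′)  ≡⟨ aut-preservesClosedAdj σ u x′ ⟩
    closedAdj G u x′                ≡⟨ uv x′ ⟩
    closedAdj G v x′                ≡⟨ sym (aut-preservesClosedAdj σ v x′) ⟩
    closedAdj G (σ $ₐ v) (σ $ₐ x′)  ≡⟨ cong (closedAdj G (σ $ₐ v)) (inverseʳ (perm σ)) ⟩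
    closedAdj G (σ $ₐ v) x          ∎
    where x′ = invAut σ $ₐ x

ancestor : ∀ {n m} → Dups n m → Fin m → Fin n
ancestor done      x       = x
ancestor (dup d w) zero    = ancestor d w
ancestor (dup d w) (suc x) = ancestor d x

ancestor-orig : ∀ {n m} (d : Dups n m) i → ancestor d (orig d i) ≡ i
ancestor-orig done      i = refl
ancestor-orig (dup d w) i = ancestor-orig d i

closedAdj-build : ∀ {n m} (Γ : Graph n) (d : Dups n m) u v →
  closedAdj (build Γ d) u v ≡ closedAdj Γ (ancestor d u) (ancestor d v)
closedAdj-build Γ done      u       v       = refl
closedAdj-build Γ (dup d w) zero    zero    = sym (closedAdj-refl Γ (ancestor d w))
closedAdj-build Γ (dup d w) zero    (suc y) = closedAdj-build Γ d w y
closedAdj-build Γ (dup d w) (suc x) zero    =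
  trans (closedAdj-build Γ d w x) (closedAdj-sym Γ (ancestor d w) (ancestor d x))
closedAdj-build Γ (dup d w) (suc x) (suc y) =
  trans (cong (_∨ adj (build Γ d) x y) (==-suc x y)) (closedAdj-build Γ d x y)

-- G arises from Γ by replacing each vertex i by the clique π⁻¹(i) of twins,
-- with ι choosing a representative in each clique.
module CliqueBlowUp {n m} (Γ : Graph n) (base : IsBase Γ) (G : Graph m)
  (π : Fin m → Fin n) (ι : Fin n → Fin m) (π∘ι : ∀ i → π (ι i) ≡ i)
  (closedAdj-π : ∀ u v → closedAdj G u v ≡ closedAdj Γ (π u) (π v)) where

  π-≡⇒trueTwins : ∀ {u v} → π u ≡ π v → TrueTwins G u v
  π-≡⇒trueTwins {u} {v} πu≡πv x = begin
    closedAdj G u x          ≡⟨ closedAdj-π u x ⟩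
    closedAdj Γ (π u) (π x)  ≡⟨ cong (λ i → closedAdj Γ i (π x)) πu≡πv ⟩
    closedAdj Γ (π v) (π x)  ≡⟨ sym (closedAdj-π v x) ⟩
    closedAdj G v x          ∎

  trueTwins⇒π-≡ : ∀ {u v} → TrueTwins G u v → π u ≡ π v
  trueTwins⇒π-≡ {u} {v} uv = base (π u) (π v) λ i → begin
    closedAdj Γ (π u) i          ≡⟨ cong (closedAdj Γ (π u)) (sym (π∘ι i)) ⟩
    closedAdj Γ (π u) (π (ι i))  ≡⟨ sym (closedAdj-π u (ι i)) ⟩
    closedAdj G u (ι i)          ≡⟨ uv (ι i) ⟩
    closedAdj G v (ι i)          ≡⟨ closedAdj-π v (ι i) ⟩
    closedAdj Γ (π v) (π (ι i))  ≡⟨ cong (closedAdj Γ (π v)) (π∘ι i) ⟩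
    closedAdj Γ (π v) i          ∎

  induced : Aut G → Fin n → Fin n
  induced σ i = π (σ $ₐ ι i)

  π-natural : (σ : Aut G) → ∀ u → π (σ $ₐ u) ≡ induced σ (π u)
  π-natural σ u =
    trueTwins⇒π-≡ (aut-trueTwins σ (π-≡⇒trueTwins (sym (π∘ι (π u)))))

  induced-inverseʳ : (σ : Aut G) → ∀ i → induced σ (induced (invAut σ) i) ≡ i
  induced-inverseʳ σ i = begin
    induced σ (π (invAut σ $ₐ ι i))  ≡⟨ sym (π-natural σ (invAut σ $ₐ ι i)) ⟩
    π (σ $ₐ (invAut σ $ₐ ι i))       ≡⟨ cong π (inverseʳ (perm σ)) ⟩
    π (ι i)                          ≡⟨ π∘ι i ⟩
    i                                ∎

  induced-inverseˡ : (σ : Aut G) → ∀ i → induced (invAut σ) (induced σ i) ≡ i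
  induced-inverseˡ σ i = begin
    induced (invAut σ) (π (σ $ₐ ι i))  ≡⟨ sym (π-natural (invAut σ) (σ $ₐ ι i)) ⟩
    π (invAut σ $ₐ (σ $ₐ ι i))         ≡⟨ cong π (inverseˡ (perm σ)) ⟩
    π (ι i)                            ≡⟨ π∘ι i ⟩
    i                                  ∎

  inducedPerm : Aut G → Permutation′ n
  inducedPerm σ = permutation (induced σ) (induced (invAut σ))
                              (induced-inverseʳ σ) (induced-inverseˡ σ)

  induced-preservesClosedAdj : (σ : Aut G) → PreservesClosedAdj Γ (induced σ)
  induced-preservesClosedAdj σ i j = begin
    closedAdj Γ (π (σ $ₐ ι i)) (π (σ $ₐ ι j))  ≡⟨ sym (closedAdj-π (σ $ₐ ι i) (σ $ₐ ι j)) ⟩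
    closedAdj G (σ $ₐ ι i) (σ $ₐ ι j)          ≡⟨ aut-preservesClosedAdj σ (ι i) (ι j) ⟩
    closedAdj G (ι i) (ι j)                    ≡⟨ closedAdj-π (ι i) (ι j) ⟩
    closedAdj Γ (π (ι i)) (π (ι j))            ≡⟨ cong₂ (closedAdj Γ) (π∘ι i) (π∘ι j) ⟩
    closedAdj Γ i j                            ∎

  inducedAut : Aut G → Aut Γ
  inducedAut σ = record
    { perm     = inducedPerm σ
    ; preserve = preservesClosedAdj⇒preservesAdj Γ (induced σ)
                   (Injection.injective (↔⇒↣ (inducedPerm σ)))
                   (induced-preservesClosedAdj σ)
    }

  inducedAut-hom : ∀ σ τ → inducedAut (σ ∘ₐ τ) ≈ₐ (inducedAut σ ∘ₐ inducedAut τ)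
  inducedAut-hom σ τ i = π-natural σ (τ $ₐ ι i)

  Image : Aut Γ → Set
  Image κ = Σ (Aut G) λ σ → inducedAut σ ≈ₐ κ

  image-isSubgroup : IsSubgroup Γ Image
  image-isSubgroup = record
    { resp   = λ { σ≈τ (φ , φ↦σ) → φ , λ i → trans (φ↦σ i) (σ≈τ i) }
    ; hasId  = idAut , π∘ι
    ; closed = λ { {κ} {λ′} (σ , σ↦κ) (τ , τ↦λ′) → σ ∘ₐ τ , λ i → begin
        induced (σ ∘ₐ τ) i       ≡⟨ inducedAut-hom σ τ i ⟩
        induced σ (induced τ i)  ≡⟨ cong (induced σ) (τ↦λ′ i) ⟩
        induced σ (λ′ $ₐ i)      ≡⟨ σ↦κ (λ′ $ₐ i) ⟩
        κ $ₐ (λ′ $ₐ i)           ∎ }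
    ; hasInv = λ { {κ} (σ , σ↦κ) → invAut σ , λ i → begin
        induced (invAut σ) i                        ≡⟨ sym (inverseˡ (perm κ)) ⟩
        invAut κ $ₐ (κ $ₐ induced (invAut σ) i)     ≡⟨ cong (invAut κ $ₐ_) (sym (σ↦κ _)) ⟩
        invAut κ $ₐ induced σ (induced (invAut σ) i) ≡⟨ cong (invAut κ $ₐ_) (induced-inverseʳ σ i) ⟩
        invAut κ $ₐ i                               ∎ }
    }

  PreservesTwinClasses : Aut G → Set
  PreservesTwinClasses φ = ∀ i v → TrueTwins G (ι i) v ⇔ TrueTwins G (ι i) (φ $ₐ v)

  inducedAut-trivial⇔preservesTwinClasses : ∀ φ →
    (inducedAut φ ≈ₐ idAut) ⇔ PreservesTwinClasses φ
  inducedAut-trivial⇔preservesTwinClasses φ = mk⇔ to from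
    where
    to : inducedAut φ ≈ₐ idAut → PreservesTwinClasses φ
    to φ-triv i v = mk⇔
      (λ t → π-≡⇒trueTwins (trans (trueTwins⇒π-≡ t) (sym π-φ-invariant)))
      (λ t → π-≡⇒trueTwins (trans (trueTwins⇒π-≡ t) π-φ-invariant))
      where
      π-φ-invariant : π (φ $ₐ v) ≡ π v
      π-φ-invariant = trans (π-natural φ v) (φ-triv (π v))
    from : PreservesTwinClasses φ → inducedAut φ ≈ₐ idAut
    from φ-pres i =
      trans (sym (trueTwins⇒π-≡ (Equivalence.to (φ-pres i (ι i)) (λ _ → refl)))) (π∘ι i)

  inducedAut-≈⇔ : ∀ σ τ →
    (inducedAut σ ≈ₐ inducedAut τ) ⇔ (inducedAut (invAut σ ∘ₐ τ) ≈ₐ idAut)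
  inducedAut-≈⇔ σ τ = mk⇔ to from
    where
    to : inducedAut σ ≈ₐ inducedAut τ → inducedAut (invAut σ ∘ₐ τ) ≈ₐ idAut
    to σ≈τ i = begin
      induced (invAut σ ∘ₐ τ) i              ≡⟨ inducedAut-hom (invAut σ) τ i ⟩
      induced (invAut σ) (induced τ i)       ≡⟨ cong (induced (invAut σ)) (sym (σ≈τ i)) ⟩
      induced (invAut σ) (induced σ i)       ≡⟨ induced-inverseˡ σ i ⟩
      i                                      ∎
    from : inducedAut (invAut σ ∘ₐ τ) ≈ₐ idAut → inducedAut σ ≈ₐ inducedAut τ
    from triv i = begin
      induced σ i                                    ≡⟨ cong (induced σ) (sym (triv i)) ⟩
      induced σ (induced (invAut σ ∘ₐ τ) i)          ≡⟨ cong (induced σ) (inducedAut-hom (invAut σ) τ i) ⟩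
      induced σ (induced (invAut σ) (induced τ i))   ≡⟨ induced-inverseʳ σ (induced τ i) ⟩
      induced τ i                                    ∎

mainTheorem4 : ∀ {n m} (Γ : Graph n) → IsBase Γ → (d : Dups n m) →
    Σ (Aut Γ → Set) (λ K → IsSubgroup Γ K × QuotientIso Γ d K)
mainTheorem4 Γ base d = Image , image-isSubgroup , record
  { f      = inducedAut
  ; hom    = inducedAut-hom
  ; into   = λ σ → σ , λ _ → refl
  ; onto   = λ _ κ∈Image → κ∈Image
  ; kerIsH = λ σ τ → inducedAut-trivial⇔preservesTwinClasses (invAut σ ∘ₐ τ)
                       ⇔-∘ inducedAut-≈⇔ σ τ
  }
  where
  open CliqueBlowUp Γ base (build Γ d) (ancestor d) (orig d)
                    (ancestor-orig d) (closedAdj-build Γ d)
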